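{- Let $m,k,d$ be nonnegative integers, $\epsilon>0$, and $s_1,\dots,s_n\in\{0,1\}^m$. Let $x\in S_{k,m}$ be such that $\mathrm{H}(x,s_i)\ge(1+\epsilon)d$ for some $i\in\{1,\dots,n\}$. Let $s^*\in S_{k,m}$ be any string with $\mathrm{H}(s^*,s_j)\le d$ for all $j=1,\dots,n$. Define \[P_0^*=\{a\in[m]: x[a]=0,\ s_i[a]=1,\ s^*[a]=1\},\qquad P_1^*=\{a\in[m]: x[a]=1,\ s_i[a]=0,\ s^*[a]=0\}.\] Then $\min(|P_0^*|,|P_1^*|)\ge \frac{\epsilon d}{2}$.
   Context: $[m]=\{1,\dots,m\}$; for a string $s\in\{0,1\}^m$, $s[a]$ is its $a$-th letter; $\mathrm{H}(x,y)$ is the Hamming distance; $S_{k,m}$ is the set of strings in $\{0,1\}^m$ with exactly $k$ ones.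
   Formalization: The parameter ε ranges over the positive rationals. -}

module Defs where

open import Data.Nat using (ℕ; zero; suc; _+_)
open import Data.Bool using (Bool; true; false; if_then_else_; _xor_; not; _∧_)
open import Data.Fin using (Fin; zero; suc)
open import Data.Vec using (Vec; lookup)
open import Data.Integer using (+_)
open import Data.Rational using (ℚ; _/_)

-- binary strings of length m: {0,1}^m, with true = 1, false = 0
Str : ℕ → Set
Str m = Vec Bool m

card : ∀ {m} → (Fin m → Bool) → ℕ
card {zero}  P = 0
card {suc m} P = (if P zero then 1 else 0) + card (λ a → P (suc a))

ones : ∀ {m} → Str m → ℕ
ones x = card (lookup x)

InS : (k m : ℕ) → Str m → Set
InS k m x = ones x ≡ k
  where open import Relation.Binary.PropositionalEquality using (_≡_)

H : ∀ {m} → Str m → Str m → ℕ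
H x y = card (λ a → lookup x a xor lookup y a)

P0* : ∀ {m} → Str m → Str m → Str m → Fin m → Bool
P0* x si s* a = not (lookup x a) ∧ lookup si a ∧ lookup s* a

P1* : ∀ {m} → Str m → Str m → Str m → Fin m → Bool
P1* x si s* a = lookup x a ∧ not (lookup si a) ∧ not (lookup s* a)

ℕ→ℚ : ℕ → ℚ
ℕ→ℚ n = + n / 1

-- Compare x and s* with sᵢ position by position: H(x,sᵢ) − H(s*,sᵢ) + |s*| − |x|
-- gains 2 at each position of P₀*, loses 2 at each position where x = sᵢ = 1 and
-- s* = 0, and is unchanged elsewhere. As |x| = |s*| = k, this gives
-- H(x,sᵢ) ≤ H(s*,sᵢ) + 2|P₀*| ≤ d + 2|P₀*|; exchanging the roles of 0 and 1 gives
-- the same bound with P₁*, hence (1 + ε) d ≤ d + 2 min(|P₀*|, |P₁*|).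
module Submission where

open import Defs
open import Data.Nat using (ℕ; _⊓_)
open import Data.Fin using (Fin)
import Data.Fin as Fin
open import Data.Rational using (ℚ; 0ℚ; 1ℚ; ½; _+_; _*_; _≤_; _<_)
open import Relation.Binary.PropositionalEquality using (_≡_)

import Data.Nat as ℕ
import Data.Nat.Properties as ℕ
import Data.Nat.Solver as ℕ-Solver
open import Data.Nat.Coprimality using (1-coprimeTo)
import Data.Nat.Coprimality as Coprimality
import Data.Integer as ℤ
import Data.Integer.Properties as ℤ
open import Data.Rational using (mkℚ; *≤*; -_; _/_)
import Data.Rational.Properties as ℚ
open import Data.Rational.Solver using (module +-*-Solver)
open import Data.Bool using (Bool; true; false; not; _∧_; _xor_; if_then_else_)
open import Data.Vec using (lookup)
open import Data.Sum using (inj₁; inj₂)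
open import Function using (_∘_)
open import Relation.Binary.PropositionalEquality
  using (refl; sym; trans; cong; cong₂; subst; subst₂; module ≡-Reasoning)

ℕ→ℚ≡mkℚ : ∀ n → ℕ→ℚ n ≡ mkℚ (ℤ.+ n) 0 (Coprimality.sym (1-coprimeTo n))
ℕ→ℚ≡mkℚ n = ℚ.normalize-coprime (Coprimality.sym (1-coprimeTo n))

ℕ→ℚ-mono-≤ : ∀ {a b} → a ℕ.≤ b → ℕ→ℚ a ≤ ℕ→ℚ b
ℕ→ℚ-mono-≤ {a} {b} a≤b rewrite ℕ→ℚ≡mkℚ a | ℕ→ℚ≡mkℚ b =
  *≤* (subst₂ ℤ._≤_ (sym (ℤ.*-identityʳ (ℤ.+ a))) (sym (ℤ.*-identityʳ (ℤ.+ b))) (ℤ.+≤+ a≤b))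

ℕ→ℚ-homo-+ : ∀ a b → ℕ→ℚ (a ℕ.+ b) ≡ ℕ→ℚ a + ℕ→ℚ b
ℕ→ℚ-homo-+ a b rewrite ℕ→ℚ≡mkℚ a | ℕ→ℚ≡mkℚ b =
  cong (_/ 1) (sym (cong₂ ℤ._+_ (ℤ.*-identityʳ (ℤ.+ a)) (ℤ.*-identityʳ (ℤ.+ b))))

half-gap-≤ : (ε D h p : ℚ) → (1ℚ + ε) * D ≤ h → h ≤ (p + p) + D → ε * D * ½ ≤ p
half-gap-≤ ε D h p lower upper = begin
  ε * D * ½                     ≡⟨ cong (_* ½) (solve 2 (λ e d → e :* d := :- d :+ ((con 1ℚ :+ e) :* d)) refl ε D) ⟩
  (- D + (1ℚ + ε) * D) * ½      ≤⟨ ℚ.*-monoʳ-≤-nonNeg ½ (ℚ.+-monoʳ-≤ (- D) (ℚ.≤-trans lower upper)) ⟩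
  (- D + ((p + p) + D)) * ½     ≡⟨ solve 2 (λ d p → (:- d :+ ((p :+ p) :+ d)) :* con ½ := p) refl D p ⟩
  p                             ∎
  where
  open ℚ.≤-Reasoning
  open +-*-Solver

indicator : Bool → ℕ
indicator b = if b then 1 else 0

weighted-card : ∀ {m} (P Q R : Fin m → Bool) → ℕ
weighted-card P Q R = card P ℕ.+ card Q ℕ.+ 2 ℕ.* card R

weight : ∀ {m} (P Q R : Fin m → Bool) → Fin m → ℕ
weight P Q R a = indicator (P a) ℕ.+ indicator (Q a) ℕ.+ 2 ℕ.* indicator (R a)

weighted-card-suc : ∀ {m} (P Q R : Fin (ℕ.suc m) → Bool) →
  weighted-card P Q R ≡ weight P Q R Fin.zero ℕ.+ weighted-card (P ∘ Fin.suc) (Q ∘ Fin.suc) (R ∘ Fin.suc)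
weighted-card-suc P Q R =
  solve 6 (λ a b c x y z → (a :+ x) :+ (b :+ y) :+ con 2 :* (c :+ z) := (a :+ b :+ con 2 :* c) :+ (x :+ y :+ con 2 :* z))
    refl (indicator (P Fin.zero)) (indicator (Q Fin.zero)) (indicator (R Fin.zero))
         (card (P ∘ Fin.suc)) (card (Q ∘ Fin.suc)) (card (R ∘ Fin.suc))
  where open ℕ-Solver.+-*-Solver

weighted-card-cong : ∀ {m} (P Q R P′ Q′ R′ : Fin m → Bool) →
  (∀ a → weight P Q R a ≡ weight P′ Q′ R′ a) → weighted-card P Q R ≡ weighted-card P′ Q′ R′
weighted-card-cong {ℕ.zero}  P Q R P′ Q′ R′ pointwise = refl
weighted-card-cong {ℕ.suc m} P Q R P′ Q′ R′ pointwise = begin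
  weighted-card P Q R
    ≡⟨ weighted-card-suc P Q R ⟩
  weight P Q R Fin.zero ℕ.+ weighted-card (P ∘ Fin.suc) (Q ∘ Fin.suc) (R ∘ Fin.suc)
    ≡⟨ cong₂ ℕ._+_ (pointwise Fin.zero) (weighted-card-cong _ _ _ _ _ _ (pointwise ∘ Fin.suc)) ⟩
  weight P′ Q′ R′ Fin.zero ℕ.+ weighted-card (P′ ∘ Fin.suc) (Q′ ∘ Fin.suc) (R′ ∘ Fin.suc)
    ≡⟨ weighted-card-suc P′ Q′ R′ ⟨
  weighted-card P′ Q′ R′
    ∎
  where open ≡-Reasoning

P0*-balance : ∀ {m} (x s t : Str m) →
  weighted-card (lookup t) (λ a → lookup x a xor lookup s a) (P0* t s x)
    ≡ weighted-card (lookup x) (λ a → lookup t a xor lookup s a) (P0* x s t)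
P0*-balance x s t = weighted-card-cong _ _ _ _ _ _ (λ a → balance (lookup x a) (lookup s a) (lookup t a))
  where
  balance : ∀ bx bs bt →
    indicator bt ℕ.+ indicator (bx xor bs) ℕ.+ 2 ℕ.* indicator (not bt ∧ bs ∧ bx)
      ≡ indicator bx ℕ.+ indicator (bt xor bs) ℕ.+ 2 ℕ.* indicator (not bx ∧ bs ∧ bt)
  balance false false false = refl
  balance false false true  = refl
  balance false true  false = refl
  balance false true  true  = refl
  balance true  false false = refl
  balance true  false true  = refl
  balance true  true  false = refl
  balance true  true  true  = refl

P1*-balance : ∀ {m} (x s t : Str m) →
  weighted-card (lookup x) (λ a → lookup x a xor lookup s a) (P1* t s x)
    ≡ weighted-card (lookup t) (λ a → lookup t a xor lookup s a) (P1* x s t)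
P1*-balance x s t = weighted-card-cong _ _ _ _ _ _ (λ a → balance (lookup x a) (lookup s a) (lookup t a))
  where
  balance : ∀ bx bs bt →
    indicator bx ℕ.+ indicator (bx xor bs) ℕ.+ 2 ℕ.* indicator (bt ∧ not bs ∧ not bx)
      ≡ indicator bt ℕ.+ indicator (bt xor bs) ℕ.+ 2 ℕ.* indicator (bx ∧ not bs ∧ not bt)
  balance false false false = refl
  balance false false true  = refl
  balance false true  false = refl
  balance false true  true  = refl
  balance true  false false = refl
  balance true  false true  = refl
  balance true  true  false = refl
  balance true  true  true  = refl

balance⇒≤ : ∀ {j k h e a p} → j ≡ k →
  j ℕ.+ h ℕ.+ 2 ℕ.* a ≡ k ℕ.+ e ℕ.+ 2 ℕ.* p → h ℕ.≤ p ℕ.+ p ℕ.+ e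
balance⇒≤ {j} {k} {h} {e} {a} {p} refl balance = begin
  h                  ≤⟨ ℕ.m≤m+n h (2 ℕ.* a) ⟩
  h ℕ.+ 2 ℕ.* a      ≡⟨ ℕ.+-cancelˡ-≡ j _ _ (trans (sym (ℕ.+-assoc j h _)) (trans balance (ℕ.+-assoc j e _))) ⟩
  e ℕ.+ 2 ℕ.* p      ≡⟨ solve 2 (λ e p → e :+ con 2 :* p := p :+ p :+ e) refl e p ⟩
  p ℕ.+ p ℕ.+ e      ∎
  where
  open ℕ.≤-Reasoning
  open ℕ-Solver.+-*-Solver

H-≤-P0* : ∀ {m} (x s t : Str m) → ones x ≡ ones t →
  H x s ℕ.≤ card (P0* x s t) ℕ.+ card (P0* x s t) ℕ.+ H t s
H-≤-P0* x s t same-ones =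
  balance⇒≤ {a = card (P0* t s x)} {p = card (P0* x s t)} (sym same-ones) (P0*-balance x s t)

H-≤-P1* : ∀ {m} (x s t : Str m) → ones x ≡ ones t →
  H x s ℕ.≤ card (P1* x s t) ℕ.+ card (P1* x s t) ℕ.+ H t s
H-≤-P1* x s t same-ones =
  balance⇒≤ {a = card (P1* t s x)} {p = card (P1* x s t)} same-ones (P1*-balance x s t)

≤-image-⊓ : ∀ (f : ℕ → ℕ) {h p q} → h ℕ.≤ f p → h ℕ.≤ f q → h ℕ.≤ f (p ⊓ q)
≤-image-⊓ f {h} {p} {q} h≤fp h≤fq with ℕ.⊓-sel p q
... | inj₁ p⊓q≡p = subst (λ r → h ℕ.≤ f r) (sym p⊓q≡p) h≤fp
... | inj₂ p⊓q≡q = subst (λ r → h ℕ.≤ f r) (sym p⊓q≡q) h≤fq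

lemma2 : (m k d n : ℕ) (ε : ℚ) → 0ℚ < ε →
         (s : Fin n → Str m) (x : Str m) → InS k m x →
         (i : Fin n) → (1ℚ + ε) * ℕ→ℚ d ≤ ℕ→ℚ (H x (s i)) →
         (s* : Str m) → InS k m s* → (∀ j → H s* (s j) Data.Nat.≤ d) →
         ε * ℕ→ℚ d * ½ ≤ ℕ→ℚ (card (P0* x (s i) s*) ⊓ card (P1* x (s i) s*))
lemma2 m k d n ε _ s x x∈S i far s* s*∈S close = half-gap-≤ ε (ℕ→ℚ d) (ℕ→ℚ (H x (s i))) (ℕ→ℚ p) far (begin
    ℕ→ℚ (H x (s i))          ≤⟨ ℕ→ℚ-mono-≤ (≤-image-⊓ (λ q → q ℕ.+ q ℕ.+ d) {p = p₀} {q = p₁}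
                                  (bound p₀ (H-≤-P0* x (s i) s* same-ones)) (bound p₁ (H-≤-P1* x (s i) s* same-ones))) ⟩
    ℕ→ℚ (p ℕ.+ p ℕ.+ d)      ≡⟨ trans (ℕ→ℚ-homo-+ (p ℕ.+ p) d) (cong (_+ ℕ→ℚ d) (ℕ→ℚ-homo-+ p p)) ⟩
    ℕ→ℚ p + ℕ→ℚ p + ℕ→ℚ d    ∎)
  where
  open ℚ.≤-Reasoning
  p₀ = card (P0* x (s i) s*)
  p₁ = card (P1* x (s i) s*)
  p = p₀ ⊓ p₁
  same-ones : ones x ≡ ones s*
  same-ones = trans x∈S (sym s*∈S)
  bound : ∀ {h} q → h ℕ.≤ q ℕ.+ q ℕ.+ H s* (s i) → h ℕ.≤ q ℕ.+ q ℕ.+ d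
  bound q h≤ = ℕ.≤-trans h≤ (ℕ.+-monoʳ-≤ (q ℕ.+ q) (close i))
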